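{- Let $\mathbf M$ and $\mathbf D$ be double Boolean algebras and $h:\mathbf M\to\mathbf D$ a dBa quasi-isomorphism. Define $\alpha_h:\mathcal F_{pr}(\mathbf D)\to\mathcal F_{pr}(\mathbf M)$ by $\alpha_h(F):=h^{ -1}(F)$ and $\beta_h:\mathcal I_{pr}(\mathbf D)\to\mathcal I_{pr}(\mathbf M)$ by $\beta_h(I):=h^{ -1}(I)$. Then $(\alpha_h,\beta_h)$ is a CTSCR-homeomorphism from $\mathbb K^T_{pr}(\mathbf D)$ to $\mathbb K^T_{pr}(\mathbf M)$.
   Context: A double Boolean algebra (dBa) is an algebra $\mathbf{D}=(D,\sqcup,\sqcap,\neg,\lrcorner,\top,\bot)$ of type $(2,2,1,1,0,0)$ such that, with $x\vee y:=\neg(\neg x\sqcap\neg y)$ and $x\wedge y:=\lrcorner(\lrcorner x\sqcup\lrcorner y)$, for all $x,y,z\in D$: $(x\sqcap x)\sqcap y=x\sqcap y$; $x\sqcap y=y\sqcap x$; $x\sqcap(y\sqcap z)=(x\sqcap y)\sqcap z$; $\neg(x\sqcap x)=\neg x$; $x\sqcap(x\sqcup y)=x\sqcap x$; $x\sqcap(y\vee z)=(x\sqcap y)\vee(x\sqcap z)$; $x\sqcap(x\vee y)=x\sqcap x$; $\neg\neg(x\sqcap y)=x\sqcap y$; $x\sqcap\neg x=\bot$; $\neg\bot=\top\sqcap\top$; $\neg\top=\bot$; the duals $(x\sqcup x)\sqcup y=x\sqcup y$; $x\sqcup y=y\sqcup x$; $x\sqcup(y\sqcup z)=(x\sqcup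 y)\sqcup z$; $\lrcorner(x\sqcup x)=\lrcorner x$; $x\sqcup(x\sqcap y)=x\sqcup x$; $x\sqcup(y\wedge z)=(x\sqcup y)\wedge(x\sqcup z)$; $x\sqcup(x\wedge y)=x\sqcup x$; $\lrcorner\lrcorner(x\sqcup y)=x\sqcup y$; $x\sqcup\lrcorner x=\top$; $\lrcorner\top=\bot\sqcup\bot$; $\lrcorner\bot=\top$; and $(x\sqcap x)\sqcup(x\sqcap x)=(x\sqcup x)\sqcap(x\sqcup x)$. The quasi-order is $x\sqsubseteq y$ iff $x\sqcap y=x\sqcap x$ and $x\sqcup y=y\sqcup y$. A dBa homomorphism preserves $\sqcup,\sqcap,\neg,\lrcorner,\top,\bot$; a quasi-isomorphism is a surjective homomorphism $h$ with $x\sqsubseteq y\iff h(x)\sqsubseteq h(y)$. A filter is $F\subseteq D$ closed under $\sqcap$ and upward closed; an ideal is $I\subseteq D$ closed under $\sqcup$ and downward closed. Primary filter: filter $F\ne D$ with $x\in F$ or $\neg x\in F$ for all $x$; primary ideal: ideal $I\neq D$ with $x\in I$ or $\lrcorner x\in I$ for all $x$ (preimages of primary filters/ideals under dBa homomorphisms are primary, so $\alpha_h,\beta_h$ are well-defined). $\mathcal F_{pr}$, $\mathcal I_{pr}$ are their sets; $F_x:=\{F:x\in F\}$, $I_x:=\{I:x\in I\}$; $\mathcal T$, $\mathcal J$ are the topologies having $\{F_x\}$, $\{I_x\}$ as subbases of closed sets; $\mathbb K^T_{pr}(\mathbf D):=((\mathcal F_{pr}(\mathbf D),\mathcal T),(\mathcal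 I_{pr}(\mathbf D),\mathcal J),\nabla)$, $F\nabla I$ iff $F\cap I=\emptyset$. A CTSCR-homeomorphism between $((G_1,\rho_1),(M_1,\tau_1),R_1)$ and $((G_2,\rho_2),(M_2,\tau_2),R_2)$ is a pair of homeomorphisms $\alpha:G_1\to G_2$, $\beta:M_1\to M_2$ with $gR_1m\iff\alpha(g)R_2\beta(m)$. -}

module Defs where

open import Level using (Level; _⊔_) renaming (suc to lsuc; zero to lzero)
open import Data.Empty using (⊥)
open import Data.Product using (Σ; ∃; _×_; _,_; proj₁; proj₂)
open import Data.Sum using (_⊎_)
open import Data.List using (List)
open import Data.List.Relation.Unary.Any using (Any)
open import Relation.Nullary using (¬_)
open import Relation.Binary.PropositionalEquality using (_≡_)

infixr 2 _⇔_
_⇔_ : ∀ {a b} → Set a → Set b → Set (a ⊔ b)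
A ⇔ B = (A → B) × (B → A)

-- Double Boolean algebras
-- Notation:  ⊔ ↦ _⊔ᵈ_ ,  ⊓ ↦ _⊓ᵈ_ ,  ¬ ↦ ∼_ ,  ⌟ ↦ ⌟_ ,  ⊤ ↦ ⊤ᵈ ,  ⊥ ↦ ⊥ᵈ.
-- The derived operations  x ∨ y := ¬(¬x ⊓ ¬y)  and  x ∧ y := ⌟(⌟x ⊔ ⌟y)
-- are written out inline in the axioms.

record DBA : Set₁ where
  infixl 6 _⊔ᵈ_
  infixl 7 _⊓ᵈ_
  infix 8 ∼_ ⌟_
  field
    Carrier : Set
    _⊔ᵈ_ _⊓ᵈ_ : Carrier → Carrier → Carrier
    ∼_ ⌟_ : Carrier → Carrier
    ⊤ᵈ ⊥ᵈ : Carrier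
    ax1a : ∀ x y → (x ⊓ᵈ x) ⊓ᵈ y ≡ x ⊓ᵈ y
    ax2a : ∀ x y → x ⊓ᵈ y ≡ y ⊓ᵈ x
    ax3a : ∀ x y z → x ⊓ᵈ (y ⊓ᵈ z) ≡ (x ⊓ᵈ y) ⊓ᵈ z
    ax4a : ∀ x → ∼ (x ⊓ᵈ x) ≡ ∼ x
    ax5a : ∀ x y → x ⊓ᵈ (x ⊔ᵈ y) ≡ x ⊓ᵈ x
    ax6a : ∀ x y z → x ⊓ᵈ (∼ (∼ y ⊓ᵈ ∼ z)) ≡ ∼ (∼ (x ⊓ᵈ y) ⊓ᵈ ∼ (x ⊓ᵈ z))
    ax7a : ∀ x y → x ⊓ᵈ (∼ (∼ x ⊓ᵈ ∼ y)) ≡ x ⊓ᵈ x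
    ax8a : ∀ x y → ∼ ∼ (x ⊓ᵈ y) ≡ x ⊓ᵈ y
    ax9a : ∀ x → x ⊓ᵈ ∼ x ≡ ⊥ᵈ
    ax10a : ∼ ⊥ᵈ ≡ ⊤ᵈ ⊓ᵈ ⊤ᵈ
    ax11a : ∼ ⊤ᵈ ≡ ⊥ᵈ
    ax1b : ∀ x y → (x ⊔ᵈ x) ⊔ᵈ y ≡ x ⊔ᵈ y
    ax2b : ∀ x y → x ⊔ᵈ y ≡ y ⊔ᵈ x
    ax3b : ∀ x y z → x ⊔ᵈ (y ⊔ᵈ z) ≡ (x ⊔ᵈ y) ⊔ᵈ z
    ax4b : ∀ x → ⌟ (x ⊔ᵈ x) ≡ ⌟ x
    ax5b : ∀ x y → x ⊔ᵈ (x ⊓ᵈ y) ≡ x ⊔ᵈ x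
    ax6b : ∀ x y z → x ⊔ᵈ (⌟ (⌟ y ⊔ᵈ ⌟ z)) ≡ ⌟ (⌟ (x ⊔ᵈ y) ⊔ᵈ ⌟ (x ⊔ᵈ z))
    ax7b : ∀ x y → x ⊔ᵈ (⌟ (⌟ x ⊔ᵈ ⌟ y)) ≡ x ⊔ᵈ x
    ax8b : ∀ x y → ⌟ ⌟ (x ⊔ᵈ y) ≡ x ⊔ᵈ y
    ax9b : ∀ x → x ⊔ᵈ ⌟ x ≡ ⊤ᵈ
    ax10b : ⌟ ⊤ᵈ ≡ ⊥ᵈ ⊔ᵈ ⊥ᵈ
    ax11b : ⌟ ⊥ᵈ ≡ ⊤ᵈ
    ax12 : ∀ x → (x ⊓ᵈ x) ⊔ᵈ (x ⊓ᵈ x) ≡ (x ⊔ᵈ x) ⊓ᵈ (x ⊔ᵈ x)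

  _⊑_ : Carrier → Carrier → Set
  x ⊑ y = (x ⊓ᵈ y ≡ x ⊓ᵈ x) × (x ⊔ᵈ y ≡ y ⊔ᵈ y)

  Subset : Set₁
  Subset = Carrier → Set

  IsFilter : Subset → Set
  IsFilter F = (∀ x y → F x → F y → F (x ⊓ᵈ y)) × (∀ x y → F x → x ⊑ y → F y)

  IsIdeal : Subset → Set
  IsIdeal I = (∀ x y → I x → I y → I (x ⊔ᵈ y)) × (∀ x y → I y → x ⊑ y → I x)

  IsPrimaryFilter : Subset → Set
  IsPrimaryFilter F = IsFilter F × (¬ (∀ x → F x)) × (∀ x → F x ⊎ F (∼ x))

  IsPrimaryIdeal : Subset → Set
  IsPrimaryIdeal I = IsIdeal I × (¬ (∀ x → I x)) × (∀ x → I x ⊎ I (⌟ x))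

  Fpr : Set₁
  Fpr = Σ Subset IsPrimaryFilter

  Ipr : Set₁
  Ipr = Σ Subset IsPrimaryIdeal

  Fsub : Carrier → Fpr → Set
  Fsub x F = proj₁ F x

  Isub : Carrier → Ipr → Set
  Isub x I = proj₁ I x

  _∇_ : Fpr → Ipr → Set
  F ∇ I = ∀ x → proj₁ F x → proj₁ I x → ⊥

  _≈F_ : Fpr → Fpr → Set
  F ≈F G = ∀ x → proj₁ F x ⇔ proj₁ G x

  _≈I_ : Ipr → Ipr → Set
  I ≈I J = ∀ x → proj₁ I x ⇔ proj₁ J x

module _ (M D : DBA) where
  private
    module M = DBA M
    module D = DBA D

  IsHom : (M.Carrier → D.Carrier) → Set
  IsHom h =
      (∀ x y → h (x M.⊔ᵈ y) ≡ h x D.⊔ᵈ h y)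
    × (∀ x y → h (x M.⊓ᵈ y) ≡ h x D.⊓ᵈ h y)
    × (∀ x → h (M.∼ x) ≡ D.∼ h x)
    × (∀ x → h (M.⌟ x) ≡ D.⌟ h x)
    × (h M.⊤ᵈ ≡ D.⊤ᵈ)
    × (h M.⊥ᵈ ≡ D.⊥ᵈ)

  IsQuasiIso : (M.Carrier → D.Carrier) → Set
  IsQuasiIso h =
      IsHom h
    × (∀ d → ∃ λ m → h m ≡ d)
    × (∀ x y → x M.⊑ y ⇔ h x D.⊑ h y)

-- The closed sets of the generated topology are exactly the arbitrary
-- intersections of finite unions of subbasic closed sets: C is closed iff
-- there are an index type J and, for each j, a finite list of subbase
-- indices Φ j, with  x ∈ C  ⇔  ∀ j, x lies in some S b, b ∈ Φ j.

record SubbaseSpace : Set₂ where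
  field
    Point : Set₁
    _≈_   : Point → Point → Set
    Index : Set
    S     : Index → Point → Set

  IsClosed : (Point → Set) → Set₁
  IsClosed C = Σ Set λ J → Σ (J → List Index) λ Φ →
                 ∀ p → C p ⇔ (∀ j → Any (λ b → S b p) (Φ j))

module _ (X Y : SubbaseSpace) where
  private
    module X = SubbaseSpace X
    module Y = SubbaseSpace Y

  Respects : (X.Point → Y.Point) → Set₁
  Respects f = ∀ p q → p X.≈ q → f p Y.≈ f q

  IsContinuous : (X.Point → Y.Point) → Set₁
  IsContinuous f = ∀ C → Y.IsClosed C → X.IsClosed (λ p → C (f p))

  IsHomeomorphism : (X.Point → Y.Point) → Set₁
  IsHomeomorphism f = Respects f × IsContinuous f ×
    Σ (Y.Point → X.Point) λ g →
      Respects' g × IsContinuous' g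
      × (∀ p → g (f p) X.≈ p) × (∀ q → f (g q) Y.≈ q)
    where
      Respects' : (Y.Point → X.Point) → Set₁
      Respects' g = ∀ p q → p Y.≈ q → g p X.≈ g q
      IsContinuous' : (Y.Point → X.Point) → Set₁
      IsContinuous' g = ∀ C → X.IsClosed C → Y.IsClosed (λ q → C (g q))

FprSpace : DBA → SubbaseSpace
FprSpace D = record
  { Point = Fpr ; _≈_ = _≈F_ ; Index = Carrier ; S = Fsub }
  where open DBA D

IprSpace : DBA → SubbaseSpace
IprSpace D = record
  { Point = Ipr ; _≈_ = _≈I_ ; Index = Carrier ; S = Isub }
  where open DBA D

IsCTSCRHomeo : (D M : DBA) → (DBA.Fpr D → DBA.Fpr M) → (DBA.Ipr D → DBA.Ipr M) → Set₁
IsCTSCRHomeo D M α β =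
    IsHomeomorphism (FprSpace D) (FprSpace M) α
  × IsHomeomorphism (IprSpace D) (IprSpace M) β
  × (∀ F I → DBA._∇_ D F I ⇔ DBA._∇_ M (α F) (β I))

{-# OPTIONS --safe #-}
module Submission where

open import Defs
open import Function using (id; _∘′_)
open import Data.Product using (Σ; _×_; _,_; proj₁; proj₂)
open import Data.Sum using (_⊎_; map)
open import Relation.Nullary using (¬_)
open import Data.List using () renaming (map to mapL)
import Data.List.Relation.Unary.Any as Any
open import Data.List.Relation.Unary.Any.Properties using (map⁺; map⁻)
open import Relation.Binary.PropositionalEquality using (_≡_; refl; sym; trans; cong; cong₂; subst; subst₂)

-- A quasi-isomorphism h identifies exactly ⊑-equivalent elements, and primary
-- filters and ideals are unions of ⊑-classes.  Hence taking preimages under h is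
-- a bijection on them, inverse to G ↦ h[G] = {d | s d ∈ G} for any section s of h.
-- Both maps pull subbasic closed sets back to subbasic closed sets (the preimage
-- of F_x is F_{h x}), so both are continuous; and by surjectivity, preimages
-- preserve disjointness.

module _ (X Y : SubbaseSpace) where
  open SubbaseSpace

  subbasic-preimage⇒continuous : (f : Point X → Point Y) (k : Index Y → Index X) →
    (∀ p b → S Y b (f p) ⇔ S X (k b) p) → IsContinuous X Y f
  subbasic-preimage⇒continuous f k f⁻¹S C (J , Φ , C-closed) =
    J , (λ j → mapL k (Φ j)) , λ p →
      (λ Cfp j → map⁺ (Any.map (proj₁ (f⁻¹S p _)) (proj₁ (C-closed (f p)) Cfp j)))
    , (λ inΦ → proj₂ (C-closed (f p)) (λ j → Any.map (proj₂ (f⁻¹S p _)) (map⁻ (inΦ j))))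

module QuasiIsomorphism (M D : DBA) (h : DBA.Carrier M → DBA.Carrier D)
                        (quasiIso : IsQuasiIso M D h) where
  private
    module M = DBA M
    module D = DBA D

  h-⊔ : ∀ x y → h (x M.⊔ᵈ y) ≡ h x D.⊔ᵈ h y
  h-⊔ = proj₁ (proj₁ quasiIso)

  h-⊓ : ∀ x y → h (x M.⊓ᵈ y) ≡ h x D.⊓ᵈ h y
  h-⊓ = proj₁ (proj₂ (proj₁ quasiIso))

  h-∼ : ∀ x → h (M.∼ x) ≡ D.∼ h x
  h-∼ = proj₁ (proj₂ (proj₂ (proj₁ quasiIso)))

  h-⌟ : ∀ x → h (M.⌟ x) ≡ D.⌟ h x
  h-⌟ = proj₁ (proj₂ (proj₂ (proj₂ (proj₁ quasiIso))))

  section : D.Carrier → M.Carrier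
  section d = proj₁ (proj₁ (proj₂ quasiIso) d)

  h∘section : ∀ d → h (section d) ≡ d
  h∘section d = proj₂ (proj₁ (proj₂ quasiIso) d)

  h-mono : ∀ {x y} → x M.⊑ y → h x D.⊑ h y
  h-mono = proj₁ (proj₂ (proj₂ quasiIso) _ _)

  h-reflects : ∀ {x y} → h x D.⊑ h y → x M.⊑ y
  h-reflects = proj₂ (proj₂ (proj₂ quasiIso) _ _)

  fibre-⊑ : ∀ {m m′} → h m ≡ h m′ → m M.⊑ m′
  fibre-⊑ {m} e = h-reflects (subst (h m D.⊑_) e (refl , refl))

  section-mono : ∀ {x y} → x D.⊑ y → section x M.⊑ section y
  section-mono {x} {y} =
    h-reflects ∘′ subst₂ D._⊑_ (sym (h∘section x)) (sym (h∘section y))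

  section-homomorphic₁ : ∀ {f : M.Carrier → M.Carrier} {g : D.Carrier → D.Carrier} →
    (∀ x → h (f x) ≡ g (h x)) → ∀ d → h (f (section d)) ≡ h (section (g d))
  section-homomorphic₁ {g = g} hf d =
    trans (hf _) (trans (cong g (h∘section d)) (sym (h∘section (g d))))

  section-homomorphic₂ : ∀ {f : M.Carrier → M.Carrier → M.Carrier}
    {g : D.Carrier → D.Carrier → D.Carrier} →
    (∀ x y → h (f x y) ≡ g (h x) (h y)) →
    ∀ d e → h (f (section d) (section e)) ≡ h (section (g d e))
  section-homomorphic₂ {g = g} hf d e =
    trans (hf _ _) (trans (cong₂ g (h∘section d) (h∘section e)) (sym (h∘section (g d e))))

  filter-saturated : ∀ {G m m′} → M.IsFilter G → h m ≡ h m′ → G m → G m′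
  filter-saturated (_ , up) e Gm = up _ _ Gm (fibre-⊑ e)

  ideal-saturated : ∀ {I m m′} → M.IsIdeal I → h m ≡ h m′ → I m → I m′
  ideal-saturated (_ , down) e Im = down _ _ Im (fibre-⊑ (sym e))

  preimageFilter : D.Fpr → M.Fpr
  preimageFilter (F , (closed , up) , proper , primary) =
    (λ m → F (h m)) , (closed′ , up′) , proper′ , primary′
    where
    closed′ : ∀ x y → F (h x) → F (h y) → F (h (x M.⊓ᵈ y))
    closed′ x y Fx Fy = subst F (sym (h-⊓ x y)) (closed _ _ Fx Fy)
    up′ : ∀ x y → F (h x) → x M.⊑ y → F (h y)
    up′ x y Fx x⊑y = up _ _ Fx (h-mono x⊑y)
    proper′ : ¬ (∀ m → F (h m))
    proper′ all = proper (λ d → subst F (h∘section d) (all (section d)))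
    primary′ : ∀ x → F (h x) ⊎ F (h (M.∼ x))
    primary′ x = map id (subst F (sym (h-∼ x))) (primary (h x))

  preimageIdeal : D.Ipr → M.Ipr
  preimageIdeal (I , (closed , down) , proper , primary) =
    (λ m → I (h m)) , (closed′ , down′) , proper′ , primary′
    where
    closed′ : ∀ x y → I (h x) → I (h y) → I (h (x M.⊔ᵈ y))
    closed′ x y Ix Iy = subst I (sym (h-⊔ x y)) (closed _ _ Ix Iy)
    down′ : ∀ x y → I (h y) → x M.⊑ y → I (h x)
    down′ x y Iy x⊑y = down _ _ Iy (h-mono x⊑y)
    proper′ : ¬ (∀ m → I (h m))
    proper′ all = proper (λ d → subst I (h∘section d) (all (section d)))
    primary′ : ∀ x → I (h x) ⊎ I (h (M.⌟ x))
    primary′ x = map id (subst I (sym (h-⌟ x))) (primary (h x))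

  -- Since G is a union of fibres of h, {d | section d ∈ G} is the image h[G].
  imageFilter : M.Fpr → D.Fpr
  imageFilter (G , isFilter@(closed , up) , proper , primary) =
    (λ d → G (section d)) , (closed′ , up′) , proper′ , primary′
    where
    closed′ : ∀ x y → G (section x) → G (section y) → G (section (x D.⊓ᵈ y))
    closed′ x y Gx Gy =
      filter-saturated isFilter (section-homomorphic₂ h-⊓ x y) (closed _ _ Gx Gy)
    up′ : ∀ x y → G (section x) → x D.⊑ y → G (section y)
    up′ x y Gx x⊑y = up _ _ Gx (section-mono x⊑y)
    proper′ : ¬ (∀ d → G (section d))
    proper′ all = proper (λ m → filter-saturated isFilter (h∘section (h m)) (all (h m)))
    primary′ : ∀ d → G (section d) ⊎ G (section (D.∼ d))
    primary′ d =
      map id (filter-saturated isFilter (section-homomorphic₁ h-∼ d)) (primary (section d))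

  imageIdeal : M.Ipr → D.Ipr
  imageIdeal (I , isIdeal@(closed , down) , proper , primary) =
    (λ d → I (section d)) , (closed′ , down′) , proper′ , primary′
    where
    closed′ : ∀ x y → I (section x) → I (section y) → I (section (x D.⊔ᵈ y))
    closed′ x y Ix Iy =
      ideal-saturated isIdeal (section-homomorphic₂ h-⊔ x y) (closed _ _ Ix Iy)
    down′ : ∀ x y → I (section y) → x D.⊑ y → I (section x)
    down′ x y Iy x⊑y = down _ _ Iy (section-mono x⊑y)
    proper′ : ¬ (∀ d → I (section d))
    proper′ all = proper (λ m → ideal-saturated isIdeal (h∘section (h m)) (all (h m)))
    primary′ : ∀ d → I (section d) ⊎ I (section (D.⌟ d))
    primary′ d =
      map id (ideal-saturated isIdeal (section-homomorphic₁ h-⌟ d)) (primary (section d))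

  member-h∘section : ∀ (P : D.Subset) d → P (h (section d)) ⇔ P d
  member-h∘section P d = subst P (h∘section d) , subst P (sym (h∘section d))

  imageFilter∘preimageFilter : ∀ F → imageFilter (preimageFilter F) D.≈F F
  imageFilter∘preimageFilter F = member-h∘section (proj₁ F)

  preimageFilter∘imageFilter : ∀ G → preimageFilter (imageFilter G) M.≈F G
  preimageFilter∘imageFilter (G , isFilter , _) m =
    filter-saturated isFilter (h∘section (h m)) , filter-saturated isFilter (sym (h∘section (h m)))

  imageIdeal∘preimageIdeal : ∀ I → imageIdeal (preimageIdeal I) D.≈I I
  imageIdeal∘preimageIdeal I = member-h∘section (proj₁ I)

  preimageIdeal∘imageIdeal : ∀ J → preimageIdeal (imageIdeal J) M.≈I J
  preimageIdeal∘imageIdeal (J , isIdeal , _) m =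
    ideal-saturated isIdeal (h∘section (h m)) , ideal-saturated isIdeal (sym (h∘section (h m)))

  preimageFilter-homeomorphism : IsHomeomorphism (FprSpace D) (FprSpace M) preimageFilter
  preimageFilter-homeomorphism =
      (λ F F′ F≈F′ m → F≈F′ (h m))
    , subbasic-preimage⇒continuous (FprSpace D) (FprSpace M) preimageFilter h (λ _ _ → id , id)
    , imageFilter
    , (λ G G′ G≈G′ d → G≈G′ (section d))
    , subbasic-preimage⇒continuous (FprSpace M) (FprSpace D) imageFilter section (λ _ _ → id , id)
    , imageFilter∘preimageFilter
    , preimageFilter∘imageFilter

  preimageIdeal-homeomorphism : IsHomeomorphism (IprSpace D) (IprSpace M) preimageIdeal
  preimageIdeal-homeomorphism =
      (λ I I′ I≈I′ m → I≈I′ (h m))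
    , subbasic-preimage⇒continuous (IprSpace D) (IprSpace M) preimageIdeal h (λ _ _ → id , id)
    , imageIdeal
    , (λ J J′ J≈J′ d → J≈J′ (section d))
    , subbasic-preimage⇒continuous (IprSpace M) (IprSpace D) imageIdeal section (λ _ _ → id , id)
    , imageIdeal∘preimageIdeal
    , preimageIdeal∘imageIdeal

  preimage-disjoint : ∀ F I → F D.∇ I ⇔ preimageFilter F M.∇ preimageIdeal I
  preimage-disjoint F I =
      (λ F∇I m → F∇I (h m))
    , (λ pre∇ d Fd Id → pre∇ (section d)
         (proj₂ (member-h∘section (proj₁ F) d) Fd) (proj₂ (member-h∘section (proj₁ I) d) Id))

mainTheorem18 : (M D : DBA) (h : DBA.Carrier M → DBA.Carrier D) → IsQuasiIso M D h →
    Σ (DBA.Fpr D → DBA.Fpr M) λ α → Σ (DBA.Ipr D → DBA.Ipr M) λ β →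
      (∀ F m → proj₁ (α F) m ⇔ proj₁ F (h m))
      × (∀ I m → proj₁ (β I) m ⇔ proj₁ I (h m))
      × IsCTSCRHomeo D M α β
mainTheorem18 M D h quasiIso =
    preimageFilter , preimageIdeal
  , (λ _ _ → id , id) , (λ _ _ → id , id)
  , preimageFilter-homeomorphism , preimageIdeal-homeomorphism , preimage-disjoint
  where open QuasiIsomorphism M D h quasiIso
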